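{- For every integer $d\ge2$, \[ \mathbf{R}^{\mathrm{DT}}_d\le\max\left\{2\mathbf{R}^{\mathrm{DT}}_{d-1}-2,\ 2+2\mathbf{R}^{\mathrm{DT}}_{d-2},\ 1+\mathbf{R}^{\mathrm{DT}}_{d-1}\right\}, \] where $\mathbf{R}^{\mathrm{DT}}_d$ is the maximum of $n(f)$ over all monotone boolean functions $f$ (on any number of variables) with $\mathrm{DT}(f)\le d$.
   Context: $f:\{0,1\}^n\to\{0,1\}$ is monotone if $x\le y$ coordinatewise implies $f(x)\le f(y)$. $n(f)$ is the number of relevant coordinates $i$ (those with $f(x)\ne f(x^i)$ for some $x$, $x^i$ being $x$ with bit $i$ flipped). $\mathrm{DT}(f)$ is the minimum depth of a deterministic decision tree computing $f$. -}

module Defs where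

open import Data.Nat using (ℕ; _≤_)
open import Data.Bool using (Bool; true; false; not; if_then_else_) renaming (_≤_ to _≤ᵇ_)
open import Data.Fin using (Fin; _≟_)
open import Data.Product using (Σ; ∃; _×_)
open import Relation.Binary.PropositionalEquality using (_≡_; _≢_)
open import Relation.Nullary using (does)
open import Function.Definitions using (Injective)

BoolFun : ℕ → Set
BoolFun n = (Fin n → Bool) → Bool

Monotone : ∀ {n} → BoolFun n → Set
Monotone {n} f = ∀ (x y : Fin n → Bool) → (∀ i → x i ≤ᵇ y i) → f x ≤ᵇ f y

flipAt : ∀ {n} → (Fin n → Bool) → Fin n → (Fin n → Bool)
flipAt x i j = if does (j ≟ i) then not (x j) else x j

Relevant : ∀ {n} → BoolFun n → Fin n → Set
Relevant f i = ∃ λ x → f x ≢ f (flipAt x i)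

NumRelevant : ∀ {n} → BoolFun n → ℕ → Set
NumRelevant {n} f m =
  Σ (Fin m → Fin n) λ g →
    Injective _≡_ _≡_ g × (∀ j → Relevant f (g j)) × (∀ i → Relevant f i → ∃ λ j → g j ≡ i)

data DTree (n : ℕ) : Set where
  leaf : Bool → DTree n
  node : Fin n → DTree n → DTree n → DTree n

eval : ∀ {n} → DTree n → (Fin n → Bool) → Bool
eval (leaf b) x = b
eval (node i l r) x = if x i then eval r x else eval l x

depth : ∀ {n} → DTree n → ℕ
depth (leaf _) = 0
depth (node _ l r) = Data.Nat.suc (depth l Data.Nat.⊔ depth r)

DT≤ : ∀ {n} → BoolFun n → ℕ → Set
DT≤ f d = ∃ λ t → depth t ≤ d × (∀ x → eval t x ≡ f x)

IsRDT : ℕ → ℕ → Set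
IsRDT d r =
  (∃ λ n → Σ (BoolFun n) λ f → Monotone f × DT≤ f d × NumRelevant f r)
  × (∀ n (f : BoolFun n) k → Monotone f → DT≤ f d → NumRelevant f k → k ≤ r)

-- Let x be the variable queried at the root of a tree of depth ≤ d for the monotone f, and
-- f₀ = f[x ≔ 0] ≤ f₁ = f[x ≔ 1]. Every relevant variable of f other than x is relevant to f₀ or
-- to f₁, so n(f) + |C| ≤ 1 + n(f₀) + n(f₁), where C is the set of variables relevant to both.
-- If f₀ ≡ 0 or f₁ ≡ 1 this gives n(f) ≤ 1 + R_{d-1}. Otherwise f₀(1) = 1 and f₁(0) = 0, while
-- f₀ u ≤ f₁ v whenever u ≤ v on C (the other coordinates can be moved freely); hence C ≠ ∅.
-- If C = {a}, then x_a = 0 forces f₀ = 0 and x_a = 1 forces f₁ = 1; if C = {a, b}, then x_a = 0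
-- forces f₀ = 0 or x_b = 1 forces f₁ = 1. When x_a = c forces g = c, the restriction
-- g[a ≔ ¬c] has depth one less and keeps every other relevant variable, so n(g) ≤ 1 + R_{d-2}.
-- The cases |C| = 1, |C| = 2 and |C| ≥ 3 give the three terms of the maximum.
module Submission where

open import Defs
open import Data.Bool using (Bool; true; false; not; if_then_else_) renaming (_≤_ to _≤ᵇ_)
import Data.Bool.Properties as 𝔹
open import Data.Empty using (⊥-elim)
open import Data.Fin using (Fin; zero; suc; _≟_)
open import Data.Fin.Properties using (injective⇒≤)
open import Data.List using (List; []; _∷_; length; filter; allFin; lookup)
open import Data.List.Membership.Propositional using (_∈_; _∉_)
open import Data.List.Membership.Propositional.Properties using (∈-filter⁺; ∈-filter⁻; ∈-allFin; ∈-lookup)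
import Data.List.Relation.Unary.All as All
open import Data.List.Relation.Unary.AllPairs using (_∷_)
open import Data.List.Relation.Unary.Any using (here; there; index)
open import Data.List.Relation.Unary.Any.Properties using (lookup-index)
open import Data.List.Relation.Unary.Unique.Propositional using (Unique)
open import Data.List.Relation.Unary.Unique.Propositional.Properties using (allFin⁺; filter⁺)
open import Data.Nat using (ℕ; zero; suc; _≤_; _+_; _*_; _∸_; _⊔_; z≤n; s≤s; s≤s⁻¹; _≤?_)
open import Data.Nat.Properties hiding (_≟_)
open import Data.Product using (∃; _,_; proj₂)
open import Data.Sum using (_⊎_; inj₁; inj₂; [_,_]′)
open import Data.Vec.Functional using (updateAt; head; tail) renaming (_∷_ to _∷ᵛ_)
open import Data.Vec.Functional.Properties
  using (∷-cong; updateAt-updates; updateAt-minimal; updateAt-id-local; updateAt-commutes)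
open import Function using (_∘_; const)
open import Level using (Level)
open import Relation.Binary using (_Respects_; _Preserves_⟶_)
open import Relation.Binary.PropositionalEquality
  using (_≡_; _≢_; _≗_; refl; sym; trans; cong; subst; subst₂; module ≡-Reasoning)
open import Relation.Nullary using (Dec; yes; no; ¬_; does; map′; _⊎-dec_; ¬?)
open import Relation.Nullary.Decidable using (decidable-stable)
open import Relation.Nullary.Negation using (contradiction)
open import Relation.Unary using (Pred; Decidable; _∪_; _∩_)
open import Relation.Unary.Properties using (_∪?_; _∩?_)

private
  variable
    ℓ : Level
    n d k : ℕ
    f g : BoolFun n
    a i : Fin n
    b c : Bool
    u v z : Fin n → Bool

infix 4 _≤ᵖ_

_≤ᵖ_ : (Fin n → Bool) → (Fin n → Bool) → Set
u ≤ᵖ v = ∀ i → u i ≤ᵇ v i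

Extensional : BoolFun n → Set
Extensional f = f Preserves _≗_ ⟶ _≡_

Constant : BoolFun n → Set
Constant f = ∃ λ b → ∀ z → f z ≡ b

Forces : BoolFun n → Fin n → Bool → Set
Forces f a c = ∀ z → z a ≡ c → f z ≡ c

≤-false : b ≤ᵇ false → b ≡ false
≤-false b≤false = 𝔹.≤-antisym b≤false (𝔹.≤-minimum _)

true-≤ : true ≤ᵇ b → b ≡ true
true-≤ true≤b = 𝔹.≤-antisym (𝔹.≤-maximum _) true≤b

monotone⇒extensional : Monotone f → Extensional f
monotone⇒extensional mono u≗v =
  𝔹.≤-antisym (mono _ _ (𝔹.≤-reflexive ∘ u≗v)) (mono _ _ (λ i → 𝔹.≤-reflexive (sym (u≗v i))))

infixl 6 _[_]≔_

_[_]≔_ : (Fin n → Bool) → Fin n → Bool → Fin n → Bool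
z [ a ]≔ b = updateAt z a (const b)

restrict : BoolFun n → Fin n → Bool → BoolFun n
restrict f a b z = f (z [ a ]≔ b)

[]≔-updates : ∀ (z : Fin n → Bool) a b → (z [ a ]≔ b) a ≡ b
[]≔-updates z a b = updateAt-updates a z

[]≔-minimal : ∀ (z : Fin n → Bool) {a j} b → j ≢ a → (z [ a ]≔ b) j ≡ z j
[]≔-minimal z {a} {j} b j≢a = updateAt-minimal j a z j≢a

[]≔-id : z a ≡ b → z [ a ]≔ b ≗ z
[]≔-id {z = z} {a = a} za≡b = updateAt-id-local a z (sym za≡b)

[]≔-cong : u ≗ v → u [ a ]≔ b ≗ v [ a ]≔ b
[]≔-cong {u = u} {v = v} {a = a} {b = b} u≗v j with j ≟ a
... | yes refl = trans ([]≔-updates u j b) (sym ([]≔-updates v j b))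
... | no j≢a = trans ([]≔-minimal u b j≢a) (trans (u≗v j) (sym ([]≔-minimal v b j≢a)))

[]≔-mono : b ≤ᵇ c → u ≤ᵖ v → u [ a ]≔ b ≤ᵖ v [ a ]≔ c
[]≔-mono {b = b} {c = c} {u = u} {v = v} {a = a} b≤c u≤v j with j ≟ a
... | yes refl rewrite []≔-updates u j b | []≔-updates v j c = b≤c
... | no j≢a rewrite []≔-minimal u b j≢a | []≔-minimal v c j≢a = u≤v j

[]≔-towards : ∀ (u v : Fin n → Bool) a j → j ≡ a ⊎ u j ≡ v j → (u [ a ]≔ v a) j ≡ v j
[]≔-towards u v a j (inj₁ refl) = []≔-updates u j (v j)
[]≔-towards u v a j (inj₂ uj≡vj) with j ≟ a
... | yes refl = []≔-updates u j (v j)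
... | no j≢a = trans ([]≔-minimal u (v a) j≢a) uj≡vj

flipAt≗[]≔ : ∀ (z : Fin n → Bool) i → flipAt z i ≗ z [ i ]≔ not (z i)
flipAt≗[]≔ z i j with j ≟ i
... | yes refl = sym ([]≔-updates z j (not (z j)))
... | no j≢i = sym ([]≔-minimal z (not (z i)) j≢i)

flipAt-minimal : ∀ (z : Fin n → Bool) {i j} → j ≢ i → flipAt z i j ≡ z j
flipAt-minimal z {i} j≢i = trans (flipAt≗[]≔ z i _) ([]≔-minimal z (not (z i)) j≢i)

flipAt-cong : ∀ i → u ≗ v → flipAt u i ≗ flipAt v i
flipAt-cong {u = u} i u≗v j rewrite u≗v j = refl

restrict-extensional : Extensional f → Extensional (restrict f a b)
restrict-extensional ext u≗v = ext ([]≔-cong u≗v)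

restrict-monotone : Monotone f → Monotone (restrict f a b)
restrict-monotone mono u v u≤v = mono _ _ ([]≔-mono 𝔹.≤-refl u≤v)

restrict-comm : Extensional f → i ≢ a → restrict (restrict f i b) a c ≗ restrict (restrict f a c) i b
restrict-comm {i = i} {a = a} ext i≢a z =
  ext (updateAt-commutes i a i≢a z)

Forces-restrict : i ≢ a → Forces f a c → Forces (restrict f i b) a c
Forces-restrict {b = b} i≢a forces z za≡c =
  forces _ (trans ([]≔-minimal z b (i≢a ∘ sym)) za≡c)

eval-extensional : (t : DTree n) → Extensional (eval t)
eval-extensional (leaf _) _ = refl
eval-extensional (node i l r) {u} {v} u≗v rewrite u≗v i with v i
... | true = eval-extensional r u≗v
... | false = eval-extensional l u≗v

eval-node : ∀ b (l r : DTree n) → u i ≡ b → eval (node i l r) u ≡ eval (if b then r else l) u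
eval-node true l r ui≡b rewrite ui≡b = refl
eval-node false l r ui≡b rewrite ui≡b = refl

restrictTree : DTree n → Fin n → Bool → DTree n
restrictTree (leaf c) a b = leaf c
restrictTree (node i l r) a b with i ≟ a
... | yes _ = if b then restrictTree r a b else restrictTree l a b
... | no _ = node i (restrictTree l a b) (restrictTree r a b)

eval-restrictTree : ∀ (t : DTree n) a b → eval (restrictTree t a b) ≗ restrict (eval t) a b
eval-restrictTree (leaf c) a b z = refl
eval-restrictTree (node i l r) a b z with i ≟ a
eval-restrictTree (node i l r) a true z | yes refl =
  trans (eval-restrictTree r i true z) (sym (eval-node true l r ([]≔-updates z i true)))
eval-restrictTree (node i l r) a false z | yes refl =
  trans (eval-restrictTree l i false z) (sym (eval-node false l r ([]≔-updates z i false)))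
eval-restrictTree (node i l r) a b z | no i≢a rewrite []≔-minimal z b i≢a with z i
... | true = eval-restrictTree r a b z
... | false = eval-restrictTree l a b z

depth-restrictTree : ∀ (t : DTree n) a b → depth (restrictTree t a b) ≤ depth t
depth-restrictTree (leaf c) a b = z≤n
depth-restrictTree (node i l r) a b with i ≟ a
depth-restrictTree (node i l r) a true | yes _ =
  m≤n⇒m≤1+n (≤-trans (depth-restrictTree r a true) (m≤n⊔m (depth l) (depth r)))
depth-restrictTree (node i l r) a false | yes _ =
  m≤n⇒m≤1+n (≤-trans (depth-restrictTree l a false) (m≤m⊔n (depth l) (depth r)))
depth-restrictTree (node i l r) a b | no _ =
  s≤s (⊔-mono-≤ (depth-restrictTree l a b) (depth-restrictTree r a b))

DT≤⇒extensional : DT≤ f d → Extensional f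
DT≤⇒extensional (t , _ , ev) {u} {v} u≗v = trans (sym (ev u)) (trans (eval-extensional t u≗v) (ev v))

DT≤-cong : f ≗ g → DT≤ f d → DT≤ g d
DT≤-cong f≗g (t , dt , ev) = t , dt , λ z → trans (ev z) (f≗g z)

DT≤-constant : (∀ z → f z ≡ b) → DT≤ f d
DT≤-constant {b = b} f≡b = leaf b , z≤n , λ z → sym (f≡b z)

DT≤-zero⇒constant : DT≤ f 0 → Constant f
DT≤-zero⇒constant (leaf b , _ , ev) = b , λ z → sym (ev z)

DT≤-restrict : DT≤ f d → DT≤ (restrict f a b) d
DT≤-restrict {a = a} {b = b} (t , dt , ev) =
  restrictTree t a b , ≤-trans (depth-restrictTree t a b) dt ,
  λ z → trans (eval-restrictTree t a b z) (ev _)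

DT≤-node : Extensional f → (∀ b → DT≤ (restrict f i b) d) → DT≤ f (suc d)
DT≤-node {f = f} {i = i} ext sub with sub false | sub true
... | l , dl , evl | r , dr , evr = node i l r , s≤s (⊔-lub dl dr) , correct
  where
  correct : ∀ z → eval (node i l r) z ≡ f z
  correct z with z i in zi
  ... | true = trans (evr z) (ext ([]≔-id zi))
  ... | false = trans (evl z) (ext ([]≔-id zi))

DT≤-split : DT≤ f (suc d) → Constant f ⊎ ∃ λ i → ∀ b → DT≤ (restrict f i b) d
DT≤-split (leaf b , _ , ev) = inj₁ (b , λ z → sym (ev z))
DT≤-split {f = f} {d = d} (node i l r , dt , ev) = inj₂ (i , subtree)
  where
  depth-child : ∀ b → depth (if b then r else l) ≤ d
  depth-child true = m⊔n≤o⇒n≤o (depth l) (depth r) (s≤s⁻¹ dt)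
  depth-child false = m⊔n≤o⇒m≤o (depth l) (depth r) (s≤s⁻¹ dt)
  subtree : ∀ b → DT≤ (restrict f i b) d
  subtree b = DT≤-cong (λ z → trans (sym (eval-node b l r ([]≔-updates z i b))) (ev _))
                       (DT≤-restrict ((if b then r else l) , depth-child b , λ _ → refl))

-- If the root queries i ≢ a, recurse into both halves; at depth one both halves are constant,
-- and forcing makes both constants c.
DT≤-unforced : Forces f a c → DT≤ f (suc d) → DT≤ (restrict f a (not c)) d
DT≤-unforced {f = f} {a = a} {c = c} {d = d} forces dt with DT≤-split dt
... | inj₁ (b , f≡b) = DT≤-constant (λ z → f≡b _)
... | inj₂ (i , sub) with i ≟ a
...   | yes refl = sub (not c)
...   | no i≢a = unforced d sub
  where
  ext = DT≤⇒extensional dt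
  unforced : ∀ d → (∀ b → DT≤ (restrict f i b) d) → DT≤ (restrict f a (not c)) d
  unforced zero sub = DT≤-constant (λ z → f≡c (z [ a ]≔ not c))
    where
    f≡c : ∀ z → f z ≡ c
    f≡c z with DT≤-zero⇒constant (sub (z i))
    ... | e , fᵢ≡e = begin
      f z                             ≡⟨ ext ([]≔-id refl) ⟨
      restrict f i (z i) z            ≡⟨ fᵢ≡e z ⟩
      e                               ≡⟨ fᵢ≡e (z [ a ]≔ c) ⟨
      restrict f i (z i) (z [ a ]≔ c) ≡⟨ forces _ a-coordinate ⟩
      c                               ∎
      where
      open ≡-Reasoning
      a-coordinate : (z [ a ]≔ c [ i ]≔ z i) a ≡ c
      a-coordinate = trans ([]≔-minimal _ (z i) (i≢a ∘ sym)) ([]≔-updates z a c)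
  unforced (suc d) sub = DT≤-node (restrict-extensional ext) λ b →
    DT≤-cong (restrict-comm ext i≢a)
      (DT≤-unforced (Forces-restrict i≢a forces) (sub b))

∃?-cube : {P : Pred (Fin n → Bool) ℓ} → P Respects _≗_ → Decidable P → Dec (∃ P)
∃?-cube {zero} resp P? = map′ (_ ,_) (λ (z , p) → resp (λ ()) p) (P? (λ ()))
∃?-cube {suc n} {P = P} resp P? =
  map′ [ (λ (z , p) → false ∷ᵛ z , p) , (λ (z , p) → true ∷ᵛ z , p) ]′ byHead
    (∃?-cube (resp ∘ ∷-cong refl) (P? ∘ (false ∷ᵛ_))
      ⊎-dec ∃?-cube (resp ∘ ∷-cong refl) (P? ∘ (true ∷ᵛ_)))
  where
  byHead : ∃ P → ∃ (P ∘ (false ∷ᵛ_)) ⊎ ∃ (P ∘ (true ∷ᵛ_))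
  byHead (z , p) with head z in z₀
  ... | false = inj₁ (tail z , resp (∷-cong z₀ (λ _ → refl)) p)
  ... | true = inj₂ (tail z , resp (∷-cong z₀ (λ _ → refl)) p)

relevant? : Extensional f → Decidable (Relevant f)
relevant? {f = f} ext i = ∃?-cube resp (λ z → ¬? (f z 𝔹.≟ f (flipAt z i)))
  where
  resp : (λ z → f z ≢ f (flipAt z i)) Respects _≗_
  resp u≗v fu≢ fv≡ = fu≢ (trans (ext u≗v) (trans fv≡ (sym (ext (flipAt-cong i u≗v)))))

relevants : {f : BoolFun n} → Extensional f → List (Fin n)
relevants ext = filter (relevant? ext) (allFin _)

Unique⇒lookup-injective : ∀ {A : Set} {xs : List A} → Unique xs →
  ∀ i j → lookup xs i ≡ lookup xs j → i ≡ j
Unique⇒lookup-injective (_ ∷ _) zero zero _ = refl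
Unique⇒lookup-injective (x∉ ∷ _) zero (suc j) eq = ⊥-elim (All.lookup x∉ (∈-lookup j) eq)
Unique⇒lookup-injective (x∉ ∷ _) (suc i) zero eq = ⊥-elim (All.lookup x∉ (∈-lookup i) (sym eq))
Unique⇒lookup-injective (_ ∷ unique) (suc i) (suc j) eq = cong suc (Unique⇒lookup-injective unique i j eq)

NumRelevant-relevants : (ext : Extensional f) → NumRelevant f (length (relevants ext))
NumRelevant-relevants ext =
  lookup (relevants ext) ,
  (λ {i} {j} → Unique⇒lookup-injective (filter⁺ (relevant? ext) (allFin⁺ _)) i j) ,
  (λ j → proj₂ (∈-filter⁻ (relevant? ext) {xs = allFin _} (∈-lookup j))) ,
  (λ i rel → let i∈ = ∈-filter⁺ (relevant? ext) (∈-allFin i) rel in index i∈ , sym (lookup-index i∈))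

NumRelevant⇒≤length : ∀ {xs} → NumRelevant f k → (∀ i → Relevant f i → i ∈ xs) → k ≤ length xs
NumRelevant⇒≤length {xs = xs} (g , injective , relevant , _) covered =
  injective⇒≤ {f = λ j → index (covered (g j) (relevant j))} λ {j} {j′} eq →
    injective (trans (lookup-index (covered (g j) (relevant j)))
              (trans (cong (lookup xs) eq) (sym (lookup-index (covered (g j′) (relevant j′))))))

constant⇒irrelevant : Constant f → ¬ Relevant f i
constant⇒irrelevant (b , f≡b) (z , fz≢) = fz≢ (trans (f≡b _) (sym (f≡b _)))

NumRelevant-constant : Constant f → NumRelevant f k → k ≤ 0
NumRelevant-constant const nr =
  NumRelevant⇒≤length {xs = []} nr λ i rel → ⊥-elim (constant⇒irrelevant const rel)

update-irrelevant : Extensional f → (Relevant f a → z a ≡ b) → f (z [ a ]≔ b) ≡ f z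
update-irrelevant {f = f} {a = a} {z = z} {b = b} ext rel⇒ with z a 𝔹.≟ b
... | yes za≡b = ext ([]≔-id za≡b)
... | no za≢b =
  trans (ext to-flip) (sym (decidable-stable (f z 𝔹.≟ f (flipAt z a)) (za≢b ∘ rel⇒ ∘ (z ,_))))
  where
  to-flip : z [ a ]≔ b ≗ flipAt z a
  to-flip j rewrite 𝔹.¬-not (za≢b ∘ sym) = sym (flipAt≗[]≔ z a j)

agree-on-relevant : {f : BoolFun n} {u v : Fin n → Bool} → Extensional f →
  (∀ i → Relevant f i → u i ≡ v i) → f u ≡ f v
agree-on-relevant {n = n} {f = f} {v = v} ext =
  agree-outside (allFin n) (λ i i∉ → contradiction (∈-allFin i) i∉)
  where
  agree-outside : ∀ {u} (L : List (Fin n)) →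
    (∀ i → i ∉ L → u i ≡ v i) → (∀ i → Relevant f i → u i ≡ v i) → f u ≡ f v
  agree-outside [] outside _ = ext (λ i → outside i λ ())
  agree-outside {u} (j ∷ L) outside agree =
    trans (sym (update-irrelevant ext (agree j))) (agree-outside L outside′ agree′)
    where
    outside′ : ∀ i → i ∉ L → (u [ j ]≔ v j) i ≡ v i
    outside′ i i∉L with i ≟ j
    ... | yes i≡j = []≔-towards u v j i (inj₁ i≡j)
    ... | no i≢j =
      []≔-towards u v j i (inj₂ (outside i λ { (here i≡j) → i≢j i≡j ; (there i∈L) → i∉L i∈L }))
    agree′ : ∀ i → Relevant f i → (u [ j ]≔ v j) i ≡ v i
    agree′ i rel = []≔-towards u v j i (inj₂ (agree i rel))

relevant-restrict : Extensional f → Relevant f i → i ≢ a → ∃ λ b → Relevant (restrict f a b) i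
relevant-restrict {a = a} ext (z , fz≢) i≢a =
  z a , z , λ eq → fz≢ (trans (sym (ext ([]≔-id refl)))
                         (trans eq (ext ([]≔-id (flipAt-minimal z (i≢a ∘ sym))))))

length-filter-∪+∩ : ∀ {A : Set} {P Q : Pred A ℓ} (P? : Decidable P) (Q? : Decidable Q) xs →
  length (filter (P? ∪? Q?) xs) + length (filter (P? ∩? Q?) xs) ≡ length (filter P? xs) + length (filter Q? xs)
length-filter-∪+∩ P? Q? [] = refl
length-filter-∪+∩ P? Q? (x ∷ xs) with P? x | Q? x | length-filter-∪+∩ P? Q? xs
... | yes _ | yes _ | ih = cong suc (trans (+-suc _ _) (trans (cong suc ih) (sym (+-suc _ _))))
... | yes _ | no _ | ih = cong suc ih
... | no _ | yes _ | ih = trans (cong suc ih) (sym (+-suc _ _))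
... | no _ | no _ | ih = ih

-- f u ≤ f u′ ≡ f w ≤ g w ≡ g v, where w copies v on the coordinates relevant to g and u′ copies w
-- on those relevant to f, so that u′ differs from u only on coordinates relevant to both.
≤-through-common-relevant : {f g : BoolFun n} {u v : Fin n → Bool} →
  Monotone f → Extensional g → (∀ z → f z ≤ᵇ g z) →
  (∀ i → Relevant f i → Relevant g i → u i ≤ᵇ v i) → f u ≤ᵇ g v
≤-through-common-relevant {f = f} {g} {u} {v} mono ext f≤g u≤v =
  𝔹.≤-trans (mono u u′ u≤u′)
    (subst (_≤ᵇ g v) (sym (agree-on-relevant ext-f u′≈w))
      (𝔹.≤-trans (f≤g w) (𝔹.≤-reflexive (agree-on-relevant ext w≈v))))
  where
  ext-f = monotone⇒extensional mono
  w u′ : Fin _ → Bool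
  w i = if does (relevant? ext i) then v i else u i
  u′ i = if does (relevant? ext-f i) then w i else u i
  u≤u′ : u ≤ᵖ u′
  u≤u′ i with relevant? ext-f i | relevant? ext i
  ... | yes rel-f | yes rel-g = u≤v i rel-f rel-g
  ... | yes _ | no _ = 𝔹.≤-refl
  ... | no _ | _ = 𝔹.≤-refl
  u′≈w : ∀ i → Relevant f i → u′ i ≡ w i
  u′≈w i rel with relevant? ext-f i
  ... | yes _ = refl
  ... | no ¬rel = contradiction rel ¬rel
  w≈v : ∀ i → Relevant g i → w i ≡ v i
  w≈v i rel with relevant? ext i
  ... | yes _ = refl
  ... | no ¬rel = contradiction rel ¬rel

RDT≤ : ℕ → ℕ → Set
RDT≤ d r = ∀ n (f : BoolFun n) k → Monotone f → DT≤ f d → NumRelevant f k → k ≤ r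

-- A relevant variable other than a stays relevant in f[a ≔ ¬c], because f[a ≔ c] is constant.
RDT≤-forced : ∀ {r} {f : BoolFun n} → RDT≤ d r → Monotone f → Forces f a c → DT≤ f (suc d) →
  NumRelevant f k → k ≤ suc r
RDT≤-forced {a = a} {c = c} {f = f} bound mono forces dt nr =
  ≤-trans (NumRelevant⇒≤length nr covered)
    (s≤s (bound _ _ _ (restrict-monotone mono) (DT≤-unforced forces dt) (NumRelevant-relevants ext-g)))
  where
  ext = monotone⇒extensional mono
  ext-g = restrict-extensional {a = a} {b = not c} ext
  covered : ∀ i → Relevant f i → i ∈ a ∷ relevants ext-g
  covered i rel with i ≟ a
  ... | yes i≡a = here i≡a
  ... | no i≢a with relevant-restrict ext rel i≢a
  ...   | b , rel-b with b 𝔹.≟ c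
  ...     | yes refl = ⊥-elim (constant⇒irrelevant (b , λ z → forces _ ([]≔-updates z a b)) rel-b)
  ...     | no b≢c = there (∈-filter⁺ (relevant? ext-g) (∈-allFin i)
                              (subst (λ b → Relevant (restrict f a b) i) (𝔹.¬-not b≢c) rel-b))

rdtRecurrence : ℕ → ℕ → ℕ
rdtRecurrence r₁ r₂ = ((2 * r₁ ∸ 2) ⊔ (2 + 2 * r₂)) ⊔ (1 + r₁)

module _ (r₁ r₂ : ℕ) where

  private
    2*m≡m+m : ∀ m → 2 * m ≡ m + m
    2*m≡m+m m = cong (m +_) (+-identityʳ m)

  ≤-rdtRecurrence-2r₁ : k ≤ 2 * r₁ ∸ 2 → k ≤ rdtRecurrence r₁ r₂
  ≤-rdtRecurrence-2r₁ = m≤n⇒m≤n⊔o (1 + r₁) ∘ m≤n⇒m≤n⊔o (2 + 2 * r₂)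

  ≤-rdtRecurrence-2r₂ : k ≤ 2 + 2 * r₂ → k ≤ rdtRecurrence r₁ r₂
  ≤-rdtRecurrence-2r₂ = m≤n⇒m≤n⊔o (1 + r₁) ∘ m≤n⇒m≤o⊔n (2 * r₁ ∸ 2)

  ≤-rdtRecurrence-r₁ : k ≤ 1 + r₁ → k ≤ rdtRecurrence r₁ r₂
  ≤-rdtRecurrence-r₁ = m≤n⇒m≤o⊔n ((2 * r₁ ∸ 2) ⊔ (2 + 2 * r₂))

  +-≤-rdtRecurrence : r₁ + r₂ ≤ rdtRecurrence r₁ r₂
  +-≤-rdtRecurrence with 2 + r₂ ≤? r₁
  ... | yes 2+r₂≤r₁ = ≤-rdtRecurrence-2r₁ (m+n≤o⇒m≤o∸n (r₁ + r₂) (begin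
    r₁ + r₂ + 2   ≡⟨ +-assoc r₁ r₂ 2 ⟩
    r₁ + (r₂ + 2) ≡⟨ cong (r₁ +_) (+-comm r₂ 2) ⟩
    r₁ + (2 + r₂) ≤⟨ +-monoʳ-≤ r₁ 2+r₂≤r₁ ⟩
    r₁ + r₁       ≡⟨ 2*m≡m+m r₁ ⟨
    2 * r₁        ∎))
    where open ≤-Reasoning
  ... | no 2+r₂≰r₁ = ≤-rdtRecurrence-2r₂ (begin
    r₁ + r₂       ≤⟨ +-monoˡ-≤ r₂ (s≤s⁻¹ (≰⇒> 2+r₂≰r₁)) ⟩
    suc r₂ + r₂   ≤⟨ n≤1+n _ ⟩
    2 + (r₂ + r₂) ≡⟨ cong (2 +_) (2*m≡m+m r₂) ⟨
    2 + 2 * r₂    ∎)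
    where open ≤-Reasoning

  -- Below, k + c ≤ suc s is the count n(f) + |C| ≤ 1 + n(f₀) + n(f₁).

  rdtRecurrence-constant : ∀ {c s} → k + c ≤ suc s → s ≤ r₁ → k ≤ rdtRecurrence r₁ r₂
  rdtRecurrence-constant {k = k} count s≤r₁ =
    ≤-rdtRecurrence-r₁ (≤-trans (m+n≤o⇒m≤o k count) (s≤s s≤r₁))

  rdtRecurrence-one : ∀ {s} → k + 1 ≤ suc s → s ≤ suc r₂ + suc r₂ → k ≤ rdtRecurrence r₁ r₂
  rdtRecurrence-one {k = k} {s} count s≤ = ≤-rdtRecurrence-2r₂ (begin
    k                ≤⟨ s≤s⁻¹ (subst (_≤ suc s) (+-comm k 1) count) ⟩
    s                ≤⟨ s≤ ⟩
    suc r₂ + suc r₂  ≡⟨ cong suc (+-suc r₂ r₂) ⟩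
    2 + (r₂ + r₂)    ≡⟨ cong (2 +_) (2*m≡m+m r₂) ⟨
    2 + 2 * r₂       ∎)
    where open ≤-Reasoning

  rdtRecurrence-two : ∀ {s} → k + 2 ≤ suc s → s ≤ suc (r₁ + r₂) → k ≤ rdtRecurrence r₁ r₂
  rdtRecurrence-two {k = k} {s} count s≤ = ≤-trans k≤ +-≤-rdtRecurrence
    where
    k≤ : k ≤ r₁ + r₂
    k≤ = s≤s⁻¹ (≤-trans (s≤s⁻¹ (subst (_≤ suc s) (+-comm k 2) count)) s≤)

  rdtRecurrence-many : ∀ {c s} → k + (3 + c) ≤ suc s → s ≤ r₁ + r₁ → k ≤ rdtRecurrence r₁ r₂
  rdtRecurrence-many {k = k} {c} {s} count s≤ = ≤-rdtRecurrence-2r₁ (m+n≤o⇒m≤o∸n k (begin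
    k + 2        ≤⟨ +-monoʳ-≤ k (m≤m+n 2 c) ⟩
    k + (2 + c)  ≤⟨ s≤s⁻¹ (subst (_≤ suc s) (+-suc k (2 + c)) count) ⟩
    s            ≤⟨ s≤ ⟩
    r₁ + r₁      ≡⟨ 2*m≡m+m r₁ ⟨
    2 * r₁       ∎))
    where open ≤-Reasoning

module RootSplit {d r₁ r₂ n} (bound₁ : RDT≤ (suc d) r₁) (bound₂ : RDT≤ d r₂)
                 {f : BoolFun n} (mono : Monotone f) (x : Fin n)
                 (sub : ∀ b → DT≤ (restrict f x b) (suc d)) where

  f₀ f₁ : BoolFun n
  f₀ = restrict f x false
  f₁ = restrict f x true

  mono₀ : Monotone f₀
  mono₀ = restrict-monotone mono

  mono₁ : Monotone f₁
  mono₁ = restrict-monotone mono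

  ext₀ : Extensional f₀
  ext₀ = monotone⇒extensional mono₀

  ext₁ : Extensional f₁
  ext₁ = monotone⇒extensional mono₁

  n₀ n₁ : ℕ
  n₀ = length (relevants ext₀)
  n₁ = length (relevants ext₁)

  union? : Decidable (Relevant f₀ ∪ Relevant f₁)
  union? = relevant? ext₀ ∪? relevant? ext₁

  common? : Decidable (Relevant f₀ ∩ Relevant f₁)
  common? = relevant? ext₀ ∩? relevant? ext₁

  common : List (Fin n)
  common = filter common? (allFin n)

  relevant-count : NumRelevant f k → k + length common ≤ suc (n₀ + n₁)
  relevant-count {k = k} nr = begin
    k + length common                  ≤⟨ +-monoˡ-≤ (length common) (NumRelevant⇒≤length nr covered) ⟩
    suc (length union + length common) ≡⟨ cong suc (length-filter-∪+∩ _ _ (allFin n)) ⟩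
    suc (n₀ + n₁)                      ∎
    where
    open ≤-Reasoning
    union = filter union? (allFin n)
    covered : ∀ i → Relevant f i → i ∈ x ∷ union
    covered i rel with i ≟ x
    ... | yes i≡x = here i≡x
    ... | no i≢x with relevant-restrict (monotone⇒extensional mono) rel i≢x
    ...   | false , rel₀ = there (∈-filter⁺ union? (∈-allFin i) (inj₁ rel₀))
    ...   | true , rel₁ = there (∈-filter⁺ union? (∈-allFin i) (inj₂ rel₁))

  CommonCover : List (Fin n) → Set
  CommonCover Cs = ∀ i → Relevant f₀ i → Relevant f₁ i → i ∈ Cs

  common-covers : CommonCover common
  common-covers i rel₀ rel₁ = ∈-filter⁺ common? (∈-allFin i) (rel₀ , rel₁)

  ≤-on-cover : ∀ {Cs u v} → CommonCover Cs → (∀ i → i ∈ Cs → u i ≤ᵇ v i) → f₀ u ≤ᵇ f₁ v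
  ≤-on-cover cover u≤v =
    ≤-through-common-relevant mono₀ ext₁ f₀≤f₁ λ i rel₀ rel₁ → u≤v i (cover i rel₀ rel₁)
    where
    f₀≤f₁ : ∀ z → f₀ z ≤ᵇ f₁ z
    f₀≤f₁ z = mono _ _ ([]≔-mono (𝔹.≤-minimum true) (λ _ → 𝔹.≤-refl))

  n₀≤r₁ : n₀ ≤ r₁
  n₀≤r₁ = bound₁ _ f₀ _ mono₀ (sub false) (NumRelevant-relevants ext₀)

  n₁≤r₁ : n₁ ≤ r₁
  n₁≤r₁ = bound₁ _ f₁ _ mono₁ (sub true) (NumRelevant-relevants ext₁)

  n₀-forced : Forces f₀ a c → n₀ ≤ suc r₂
  n₀-forced forces = RDT≤-forced bound₂ mono₀ forces (sub false) (NumRelevant-relevants ext₀)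

  n₁-forced : Forces f₁ a c → n₁ ≤ suc r₂
  n₁-forced forces = RDT≤-forced bound₂ mono₁ forces (sub true) (NumRelevant-relevants ext₁)

  forces₀-sole : CommonCover (a ∷ []) → f₁ (const false) ≡ false → Forces f₀ a false
  forces₀-sole cover zeros₁ z za≡false = ≤-false (subst (f₀ z ≤ᵇ_) zeros₁
    (≤-on-cover cover λ { _ (here refl) → 𝔹.≤-reflexive za≡false }))

  forces₁-sole : CommonCover (a ∷ []) → f₀ (const true) ≡ true → Forces f₁ a true
  forces₁-sole cover ones₀ z za≡true = true-≤ (subst (_≤ᵇ f₁ z) ones₀
    (≤-on-cover cover λ { _ (here refl) → 𝔹.≤-reflexive (sym za≡true) }))

  forces₀-below : f₀ (const true [ a ]≔ false) ≡ false → Forces f₀ a false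
  forces₀-below {a = a} e z za≡false = ≤-false (subst (f₀ z ≤ᵇ_) e (mono₀ _ _ λ j →
    subst (_≤ᵇ _) ([]≔-id za≡false j) ([]≔-mono 𝔹.≤-refl (λ i → 𝔹.≤-maximum (z i)) j)))

  forces₁-pair : CommonCover (a ∷ i ∷ []) → f₀ (const true [ a ]≔ false) ≡ true → Forces f₁ i true
  forces₁-pair {a = a} cover e z zi≡true = true-≤ (subst (_≤ᵇ f₁ z) e (≤-on-cover cover λ where
    _ (here refl) → subst (_≤ᵇ z a) (sym ([]≔-updates (const true) a false)) (𝔹.≤-minimum (z a))
    _ (there (here refl)) → subst (_ ≤ᵇ_) (sym zi≡true) (𝔹.≤-maximum _)))

  bound-by-common : ∀ Cs → CommonCover Cs → k + length Cs ≤ suc (n₀ + n₁) →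
    f₀ (const true) ≡ true → f₁ (const false) ≡ false → k ≤ rdtRecurrence r₁ r₂
  bound-by-common [] cover _ ones₀ zeros₁ with subst₂ _≤ᵇ_ ones₀ zeros₁ (≤-on-cover cover λ _ ())
  ... | ()
  bound-by-common (a ∷ []) cover count ones₀ zeros₁ = rdtRecurrence-one r₁ r₂ count
    (+-mono-≤ (n₀-forced (forces₀-sole cover zeros₁)) (n₁-forced (forces₁-sole cover ones₀)))
  bound-by-common (a ∷ b ∷ []) cover count _ _ with f₀ (const true [ a ]≔ false) in e
  ... | false = rdtRecurrence-two r₁ r₂ count (begin
    n₀ + n₁        ≤⟨ +-mono-≤ (n₀-forced (forces₀-below e)) n₁≤r₁ ⟩
    suc r₂ + r₁    ≡⟨ cong suc (+-comm r₂ r₁) ⟩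
    suc (r₁ + r₂)  ∎)
    where open ≤-Reasoning
  ... | true = rdtRecurrence-two r₁ r₂ count (begin
    n₀ + n₁        ≤⟨ +-mono-≤ n₀≤r₁ (n₁-forced (forces₁-pair cover e)) ⟩
    r₁ + suc r₂    ≡⟨ +-suc r₁ r₂ ⟩
    suc (r₁ + r₂)  ∎)
    where open ≤-Reasoning
  bound-by-common (_ ∷ _ ∷ _ ∷ _) cover count _ _ =
    rdtRecurrence-many r₁ r₂ count (+-mono-≤ n₀≤r₁ n₁≤r₁)

  f₀-constant : f₀ (const true) ≡ false → Constant f₀
  f₀-constant ones₀ = false , λ z →
    ≤-false (subst (f₀ z ≤ᵇ_) ones₀ (mono₀ _ _ λ i → 𝔹.≤-maximum (z i)))

  f₁-constant : f₁ (const false) ≡ true → Constant f₁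
  f₁-constant zeros₁ = true , λ z →
    true-≤ (subst (_≤ᵇ f₁ z) zeros₁ (mono₁ _ _ λ i → 𝔹.≤-minimum (z i)))

  bound : NumRelevant f k → k ≤ rdtRecurrence r₁ r₂
  bound nr with f₀ (const true) in ones₀ | f₁ (const false) in zeros₁
  ... | false | _ = rdtRecurrence-constant r₁ r₂ (relevant-count nr) (+-mono-≤ n₀≤0 n₁≤r₁)
    where
    n₀≤0 : n₀ ≤ 0
    n₀≤0 = NumRelevant-constant (f₀-constant ones₀) (NumRelevant-relevants ext₀)
  ... | true | true = rdtRecurrence-constant r₁ r₂ (relevant-count nr)
                        (≤-trans (+-mono-≤ n₀≤r₁ n₁≤0) (≤-reflexive (+-identityʳ r₁)))
    where
    n₁≤0 : n₁ ≤ 0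
    n₁≤0 = NumRelevant-constant (f₁-constant zeros₁) (NumRelevant-relevants ext₁)
  ... | true | false = bound-by-common common common-covers (relevant-count nr) ones₀ zeros₁

RDT≤-step : ∀ {d r₁ r₂} → RDT≤ (suc d) r₁ → RDT≤ d r₂ →
  RDT≤ (suc (suc d)) (rdtRecurrence r₁ r₂)
RDT≤-step bound₁ bound₂ n f k mono dt nr with DT≤-split dt
... | inj₁ const = ≤-trans (NumRelevant-constant const nr) z≤n
... | inj₂ (x , sub) = RootSplit.bound bound₁ bound₂ mono x sub nr

lemma9 : ∀ (d : ℕ) → 2 ≤ d → ∀ (r r₁ r₂ : ℕ) →
    IsRDT d r → IsRDT (d ∸ 1) r₁ → IsRDT (d ∸ 2) r₂ →
    r ≤ ((2 * r₁ ∸ 2) ⊔ (2 + 2 * r₂)) ⊔ (1 + r₁)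
lemma9 (suc (suc d)) _ r r₁ r₂ ((n , f , mono , dt , nr) , _) (_ , bound₁) (_ , bound₂) =
  RDT≤-step bound₁ bound₂ n f r mono dt nr
lemma9 (suc zero) (s≤s ()) _ _ _ _ _ _
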